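{- Let $n\ge1$, $\ell\in\mathbb{Z}$, $m\in\{0,\dots,2n\}$, $k\in\{0,\dots,m\}$, $I\subseteq[n]$ with $\#I=k$, and $J\subseteq[n]$ with $\#J=m-k$. If $\ell\le n$, then $$\beta(I)+\beta(J)+(m-k)(\ell-n)-m\binom{n+1}{2}-m\le0.$$ If $\ell>n$, then $$\beta(I)+\beta(J)-k(\ell-n)-m\binom{n+1}{2}-m\le0.$$ In both cases equality holds if and only if $m=0$.
   Context: $[n]=\{1,\dots,n\}$ and, for $I\subseteq[n]$, $\beta(I)=\sum_{i\in I}\big(\binom{i+1}{2}+i(n-i)\big)$. -}

module Defs where

open import Data.Nat using (ℕ; suc; _*_; _+_; _∸_)
open import Data.Nat.Combinatorics using (_C_)
open import Data.Fin using (Fin; toℕ)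
open import Data.Fin.Subset using (Subset)
open import Data.Fin.Subset.Properties using (_∈?_)
open import Data.List using (List; map; filter) renaming (allFin to allFinL)
open import Data.Nat.ListAction using (sum)

-- The summand of β for an element i ∈ [n]:  binom(i+1,2) + i(n-i).
-- (Here 1 ≤ i ≤ n, so n ∸ i is the true difference n - i.)
βterm : ℕ → ℕ → ℕ
βterm n i = ((suc i) C 2) + i * (n ∸ i)

-- A subset I ⊆ [n] = {1,…,n} is represented by  I : Subset n,
-- with the index  j : Fin n  standing for the element  toℕ j + 1.
-- β(I) = Σ_{i ∈ I} (binom(i+1,2) + i(n-i)).
β : (n : ℕ) → Subset n → ℕ
β n I = sum (map (λ j → βterm n (suc (toℕ j))) (filter (λ j → j ∈? I) (allFinL n)))

-- Each summand of β is at most C(n+1,2), because C(n+1,2) = C(i+1,2) + i(n-i) + C(n-i+1,2).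
-- Hence β(I) + β(J) ≤ (#I + #J) C(n+1,2) = m C(n+1,2), and as the ℓ-term is ≤ 0 in both cases the
-- left-hand side is at most -m; for m = 0 both subsets are empty and every term vanishes.
module Submission where

open import Defs
open import Data.Fin using (suc)
open import Data.Fin.Properties using (toℕ<n)
open import Data.Fin.Subset using (Subset; ∣_∣; inside; outside)
open import Data.Fin.Subset.Properties using (_∈?_)
open import Data.List using ([]; _∷_; map; filter; length; allFin; tabulate)
open import Data.List.Properties using (map-tabulate)
open import Data.Nat.ListAction using (sum)
open import Data.Nat.Combinatorics using (_C_; nC1≡n; nCk+nC[k+1]≡[n+1]C[k+1])
open import Data.Bool using (true; false)
open import Data.Product using (_×_; _,_)
open import Function using (id)
open import Function.Bundles using (_⇔_; mk⇔)
open import Relation.Nullary using (does)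
open import Relation.Binary.PropositionalEquality
import Data.Vec as Vec

-- Scopes the ℕ operators, whose names the theorem statement gives to ℤ.
module _ where
  open import Data.Nat using (ℕ; zero; suc; _+_; _*_; _∸_; _≤_; z≤n)
  open import Data.Nat.Properties
  open import Data.Nat.Tactic.RingSolver using (solve-∀)

  [n+1]C2≡n+nC2 : ∀ n → suc n C 2 ≡ n + n C 2
  [n+1]C2≡n+nC2 n = trans (sym (nCk+nC[k+1]≡[n+1]C[k+1] n 1)) (cong (_+ n C 2) (nC1≡n n))

  [1+a+d]C2≡[1+a]C2+a*d+[1+d]C2 : ∀ a d → suc (a + d) C 2 ≡ suc a C 2 + a * d + suc d C 2
  [1+a+d]C2≡[1+a]C2+a*d+[1+d]C2 a zero rewrite +-identityʳ a | *-zeroʳ a = sym (trans (+-identityʳ _) (+-identityʳ _))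
  [1+a+d]C2≡[1+a]C2+a*d+[1+d]C2 a (suc d) = begin
    suc (a + suc d) C 2                           ≡⟨ cong (λ z → suc z C 2) (+-suc a d) ⟩
    suc (suc (a + d)) C 2                         ≡⟨ [n+1]C2≡n+nC2 (suc (a + d)) ⟩
    suc (a + d) + suc (a + d) C 2                 ≡⟨ cong (suc (a + d) +_) ([1+a+d]C2≡[1+a]C2+a*d+[1+d]C2 a d) ⟩
    suc (a + d) + (suc a C 2 + a * d + suc d C 2) ≡⟨ regroup a d (suc a C 2) (suc d C 2) ⟩
    suc a C 2 + a * suc d + (suc d + suc d C 2)   ≡⟨ cong (suc a C 2 + a * suc d +_) (sym ([n+1]C2≡n+nC2 (suc d))) ⟩
    suc a C 2 + a * suc d + suc (suc d) C 2 ∎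
    where
    open ≡-Reasoning
    regroup : ∀ a d x y → suc (a + d) + (x + a * d + y) ≡ x + a * suc d + (suc d + y)
    regroup = solve-∀

  βterm≤ : ∀ {n i} → i ≤ n → βterm n i ≤ suc n C 2
  βterm≤ {n} {i} i≤n = begin
    suc i C 2 + i * (n ∸ i)                         ≤⟨ m≤m+n _ (suc (n ∸ i) C 2) ⟩
    suc i C 2 + i * (n ∸ i) + suc (n ∸ i) C 2       ≡⟨ sym ([1+a+d]C2≡[1+a]C2+a*d+[1+d]C2 i (n ∸ i)) ⟩
    suc (i + (n ∸ i)) C 2                           ≡⟨ cong (λ z → suc z C 2) (m+[n∸m]≡n i≤n) ⟩
    suc n C 2 ∎
    where open ≤-Reasoning

  sum-map≤length*bound : ∀ {A : Set} {f : A → ℕ} {b} → (∀ x → f x ≤ b) → ∀ xs → sum (map f xs) ≤ length xs * b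
  sum-map≤length*bound f≤b []       = z≤n
  sum-map≤length*bound f≤b (x ∷ xs) = +-mono-≤ (f≤b x) (sum-map≤length*bound f≤b xs)

  length-filter-∈?-map-suc : ∀ {n} s (p : Subset n) xs → length (filter (_∈? s Vec.∷ p) (map suc xs)) ≡ length (filter (_∈? p) xs)
  length-filter-∈?-map-suc s p [] = refl
  length-filter-∈?-map-suc s p (x ∷ xs) with does (x ∈? p)
  ... | true  = cong suc (length-filter-∈?-map-suc s p xs)
  ... | false = length-filter-∈?-map-suc s p xs

  length-filter-∈?-tabulate-suc : ∀ {n} s (p : Subset n) →
    length (filter (_∈? s Vec.∷ p) (tabulate suc)) ≡ length (filter (_∈? p) (allFin n))
  length-filter-∈?-tabulate-suc {n} s p = trans
    (cong (λ xs → length (filter (_∈? s Vec.∷ p) xs)) (sym (map-tabulate id suc)))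
    (length-filter-∈?-map-suc s p (allFin n))

  length-filter-∈?-allFin : ∀ {n} (p : Subset n) → length (filter (_∈? p) (allFin n)) ≡ ∣ p ∣
  length-filter-∈?-allFin Vec.[] = refl
  length-filter-∈?-allFin (inside Vec.∷ p)  = cong suc (trans (length-filter-∈?-tabulate-suc inside p) (length-filter-∈?-allFin p))
  length-filter-∈?-allFin (outside Vec.∷ p) = trans (length-filter-∈?-tabulate-suc outside p) (length-filter-∈?-allFin p)

  β≤∣I∣*[n+1]C2 : ∀ n (I : Subset n) → β n I ≤ ∣ I ∣ * (suc n C 2)
  β≤∣I∣*[n+1]C2 n I = begin
    β n I                                             ≤⟨ sum-map≤length*bound (λ j → βterm≤ (toℕ<n j)) (filter (_∈? I) (allFin n)) ⟩
    length (filter (_∈? I) (allFin n)) * (suc n C 2)  ≡⟨ cong (_* (suc n C 2)) (length-filter-∈?-allFin I) ⟩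
    ∣ I ∣ * (suc n C 2)                               ∎
    where open ≤-Reasoning

open import Data.Nat using (ℕ; zero; suc; _≤_; _∸_; z≤n) renaming (_*_ to _*ℕ_; _+_ to _+ℕ_)
import Data.Nat.Properties as ℕ
open import Data.Integer using (ℤ; +_; _+_; _-_; _*_; -_; 0ℤ; +≤+) renaming (_≤_ to _≤ℤ_; _>_ to _>ℤ_)
open import Data.Integer.Properties
  using (+-monoˡ-≤; +-monoʳ-≤; +-identityˡ; +-identityʳ; *-zeroʳ; *-monoˡ-≤-nonNeg; neg-mono-≤; i≤j⇒i-j≤0; i≤j⇒0≤j-i; <⇒≤; pos-*; ≤-trans; ≤-reflexive; module ≤-Reasoning)

+a*i≤0 : ∀ a {i} → i ≤ℤ 0ℤ → + a * i ≤ℤ 0ℤ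
+a*i≤0 a i≤0 = ≤-trans (*-monoˡ-≤-nonNeg (+ a) i≤0) (≤-reflexive (*-zeroʳ (+ a)))

-[+a*i]≤0 : ∀ a {i} → 0ℤ ≤ℤ i → - (+ a * i) ≤ℤ 0ℤ
-[+a*i]≤0 a 0≤i = neg-mono-≤ (≤-trans (≤-reflexive (sym (*-zeroʳ (+ a)))) (*-monoˡ-≤-nonNeg (+ a) 0≤i))

b+X-m*c-m≤-m : ∀ {b m c} {X : ℤ} → b ≤ m *ℕ c → X ≤ℤ 0ℤ → + b + X - + m * + c - + m ≤ℤ - + m
b+X-m*c-m≤-m {b} {m} {c} {X} b≤mc X≤0 = begin
  + b + X - + m * + c - + m   ≤⟨ +-monoˡ-≤ (- + m) (+-monoˡ-≤ (- (+ m * + c)) (+-monoʳ-≤ (+ b) X≤0)) ⟩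
  + b + 0ℤ - + m * + c - + m  ≡⟨ cong (λ z → z - + m * + c - + m) (+-identityʳ (+ b)) ⟩
  + b - + m * + c - + m       ≤⟨ +-monoˡ-≤ (- + m) (i≤j⇒i-j≤0 (subst (+ b ≤ℤ_) (pos-* m c) (+≤+ b≤mc))) ⟩
  0ℤ - + m                    ≡⟨ +-identityˡ (- + m) ⟩
  - + m                       ∎
  where open ≤-Reasoning

b+X-m*c-m≤0∧≡0⇔m≡0 : ∀ b m c (X : ℤ) → b ≤ m *ℕ c → X ≤ℤ 0ℤ → (m ≡ 0 → X ≡ 0ℤ) →
  (+ b + X - + m * + c - + m ≤ℤ 0ℤ) × (+ b + X - + m * + c - + m ≡ 0ℤ ⇔ m ≡ 0)
b+X-m*c-m≤0∧≡0⇔m≡0 b m c X b≤mc X≤0 m≡0⇒X≡0 =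
  ≤-trans b+X-m*c-m≤-m′ (neg-mono-≤ (+≤+ z≤n)) ,
  mk⇔ (λ e → 0≤-m⇒m≡0 m (subst (_≤ℤ - + m) e b+X-m*c-m≤-m′)) m≡0⇒b+X-m*c-m≡0
  where
  b+X-m*c-m≤-m′ : + b + X - + m * + c - + m ≤ℤ - + m
  b+X-m*c-m≤-m′ = b+X-m*c-m≤-m b≤mc X≤0
  0≤-m⇒m≡0 : ∀ m → 0ℤ ≤ℤ - + m → m ≡ 0
  0≤-m⇒m≡0 zero    _  = refl
  0≤-m⇒m≡0 (suc m) ()
  m≡0⇒b+X-m*c-m≡0 : m ≡ 0 → + b + X - + m * + c - + m ≡ 0ℤ
  m≡0⇒b+X-m*c-m≡0 refl rewrite ℕ.n≤0⇒n≡0 b≤mc | m≡0⇒X≡0 refl = refl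

lemma7p2 : (n : ℕ) → 1 ≤ n → (ℓ : ℤ) → (m : ℕ) → m ≤ 2 *ℕ n → (k : ℕ) → k ≤ m →
    (I J : Subset n) → ∣ I ∣ ≡ k → ∣ J ∣ ≡ m ∸ k →
    (ℓ ≤ℤ + n →
      ((+ β n I + + β n J + + (m ∸ k) * (ℓ - + n) - + m * + ((suc n) C 2) - + m) ≤ℤ + 0)
      × ((+ β n I + + β n J + + (m ∸ k) * (ℓ - + n) - + m * + ((suc n) C 2) - + m ≡ + 0) ⇔ (m ≡ 0)))
    × (ℓ >ℤ + n →
      ((+ β n I + + β n J - + k * (ℓ - + n) - + m * + ((suc n) C 2) - + m) ≤ℤ + 0)
      × ((+ β n I + + β n J - + k * (ℓ - + n) - + m * + ((suc n) C 2) - + m ≡ + 0) ⇔ (m ≡ 0)))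
lemma7p2 n _ ℓ m _ k k≤m I J ∣I∣≡k ∣J∣≡m∸k =
  (λ ℓ≤n → b+X-m*c-m≤0∧≡0⇔m≡0 (β n I +ℕ β n J) m c (+ (m ∸ k) * (ℓ - + n)) βI+βJ≤m*c
             (+a*i≤0 (m ∸ k) (i≤j⇒i-j≤0 ℓ≤n))
             (λ { refl → cong (λ z → + z * (ℓ - + n)) (ℕ.0∸n≡0 k) })) ,
  (λ ℓ>n → b+X-m*c-m≤0∧≡0⇔m≡0 (β n I +ℕ β n J) m c (- (+ k * (ℓ - + n))) βI+βJ≤m*c
             (-[+a*i]≤0 k (i≤j⇒0≤j-i (<⇒≤ ℓ>n)))
             (λ { refl → cong (λ z → - (+ z * (ℓ - + n))) (ℕ.n≤0⇒n≡0 k≤m) }))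
  where
  c : ℕ
  c = suc n C 2
  βI+βJ≤m*c : β n I +ℕ β n J ≤ m *ℕ c
  βI+βJ≤m*c = begin
    β n I +ℕ β n J            ≤⟨ ℕ.+-mono-≤ (β≤∣I∣*[n+1]C2 n I) (β≤∣I∣*[n+1]C2 n J) ⟩
    ∣ I ∣ *ℕ c +ℕ ∣ J ∣ *ℕ c  ≡⟨ cong₂ (λ x y → x *ℕ c +ℕ y *ℕ c) ∣I∣≡k ∣J∣≡m∸k ⟩
    k *ℕ c +ℕ (m ∸ k) *ℕ c    ≡⟨ sym (ℕ.*-distribʳ-+ c k (m ∸ k)) ⟩
    (k +ℕ (m ∸ k)) *ℕ c       ≡⟨ cong (_*ℕ c) (ℕ.m+[n∸m]≡n k≤m) ⟩
    m *ℕ c                    ∎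
    where open ℕ.≤-Reasoning
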